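{- The theory $\mathrm{T}_{\mathrm{pr}}$ is complete with respect to primitive recursion: for every primitive recursive function $f:\mathbb{N}^k\to\mathbb{N}$ there is a term $x_1:\mathrm{N},\dots,x_k:\mathrm{N}\vdash t:\mathrm{N}$ of $\mathrm{T}_{\mathrm{pr}}$ whose standard set-theoretic interpretation is $f$.
   Context: $\mathrm{T}_{\mathrm{pr}}$ is the following subtheory of Martin-Löf type theory. It has a cumulative hierarchy of universes $\mathrm{U}_0:\mathrm{U}_1:\cdots$ indexed by a finite or countable linear order $\{0<1<\dots\}$, each closed under $\Sigma$-types and intensional identity types. There are an empty type, a unit type and a natural numbers type $\mathrm{N}$ with $\mathsf{z}:\mathrm{N}$ and $\mathsf{s}:\mathrm{N}\to\mathrm{N}$, all in $\mathrm{U}_0$. Dependent function types exist, but for $A:\mathrm{U}_\alpha$ and $a:A\vdash B(a):\mathrm{U}_\alpha$ one only has $(a:A)\to B(a):\mathrm{U}_{\max(1,\alpha)}$. The eliminator of $\mathrm{N}$ is restricted to $\mathrm{U}_0$: given $n:\mathrm{N}\vdash C(n):\mathrm{U}_0$, $c_{\mathsf z}:C(\mathsf z)$ and $n:\mathrm{N},c:C(n)\vdash c_{\mathsf s}(n,c):C(\mathsf s n)$ (all possibly in an ambient context), there is $n:\mathrm{N}\vdash \mathsf{ind}(n):C(n)$ with $\mathsf{ind}(\mathsf z)\equiv c_{\mathsf z}$ and $\mathsf{ind}(\mathsf s n)\equiv c_{\mathsf s}(n,\mathsf{ind}(n))$. The standard interpretation in sets sends $\mathrm{N}$ to $\mathbb{N}$.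 Primitive recursive functions are those generated from constant functions, successor and projections $\mathbb{N}^k\to\mathbb{N}$ by composition and the primitive recursion scheme $\mathrm{primrec}_{g,h}(0,x)=g(x)$, $\mathrm{primrec}_{g,h}(n+1,x)=h(n,\mathrm{primrec}_{g,h}(n,x),x)$. -}

module Defs where

open import Data.Nat using (ℕ; zero; suc; _⊔_)
open import Data.Fin using (Fin)
open import Data.Vec using (Vec; []; _∷_; lookup; map)
open import Data.List using (List; []; _∷_; replicate)
open import Data.Product using (_×_; _,_; proj₁; proj₂)
open import Data.Unit using (⊤; tt)
open import Data.Empty using (⊥; ⊥-elim)
open import Relation.Binary.PropositionalEquality using (_≡_)

data PR : ℕ → Set where
  K    : ∀ {k} → ℕ → PR k
  S    : PR 1
  P    : ∀ {k} → Fin k → PR k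
  comp : ∀ {k m} → PR m → Vec (PR k) m → PR k
  rec  : ∀ {k} → PR k → PR (suc (suc k)) → PR (suc k)

mutual
  evalPR : ∀ {k} → PR k → Vec ℕ k → ℕ
  evalPR (K c)       xs       = c
  evalPR S           (x ∷ []) = suc x
  evalPR (P i)       xs       = lookup xs i
  evalPR (comp g hs) xs       = evalPR g (evalAll hs xs)
  evalPR (rec g h)   (n ∷ xs) = primrec g h n xs

  evalAll : ∀ {k m} → Vec (PR k) m → Vec ℕ k → Vec ℕ m
  evalAll []       xs = []
  evalAll (h ∷ hs) xs = evalPR h xs ∷ evalAll hs xs

  primrec : ∀ {k} → PR k → PR (suc (suc k)) → ℕ → Vec ℕ k → ℕ
  primrec g h zero    xs = evalPR g xs
  primrec g h (suc n) xs = evalPR h (n ∷ primrec g h n xs ∷ xs)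

-- The (non-dependent) fragment of T_pr: types N, 0, 1, binary Σ, Π,
-- each type living in a universe level; Π raises the level to max(1,α);
-- the eliminator of N only targets types of level 0 (i.e. in U_0).

data Ty : Set where
  `N   : Ty
  `⊥   : Ty
  `⊤   : Ty
  _`×_ : Ty → Ty → Ty
  _`⇒_ : Ty → Ty → Ty

level : Ty → ℕ
level `N         = 0
level `⊥         = 0
level `⊤         = 0
level (A `× B)   = level A ⊔ level B
level (A `⇒ B)   = 1 ⊔ (level A ⊔ level B)

Ctx : Set
Ctx = List Ty

data Var : Ctx → Ty → Set where
  vz : ∀ {Γ A} → Var (A ∷ Γ) A
  vs : ∀ {Γ A B} → Var Γ A → Var (B ∷ Γ) A

data Tm (Γ : Ctx) : Ty → Set where
  var    : ∀ {A} → Var Γ A → Tm Γ A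
  z      : Tm Γ `N
  s      : Tm Γ `N → Tm Γ `N
  unit   : Tm Γ `⊤
  absurd : ∀ {A} → Tm Γ `⊥ → Tm Γ A
  pair   : ∀ {A B} → Tm Γ A → Tm Γ B → Tm Γ (A `× B)
  fst    : ∀ {A B} → Tm Γ (A `× B) → Tm Γ A
  snd    : ∀ {A B} → Tm Γ (A `× B) → Tm Γ B
  lam    : ∀ {A B} → Tm (A ∷ Γ) B → Tm Γ (A `⇒ B)
  app    : ∀ {A B} → Tm Γ (A `⇒ B) → Tm Γ A → Tm Γ B
  ind    : ∀ {C} → level C ≡ 0 → Tm Γ C → Tm (C ∷ `N ∷ Γ) C → Tm Γ `N → Tm Γ C

⟦_⟧ty : Ty → Set
⟦ `N ⟧ty     = ℕ
⟦ `⊥ ⟧ty     = ⊥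
⟦ `⊤ ⟧ty     = ⊤
⟦ A `× B ⟧ty = ⟦ A ⟧ty × ⟦ B ⟧ty
⟦ A `⇒ B ⟧ty = ⟦ A ⟧ty → ⟦ B ⟧ty

data Env : Ctx → Set where
  []  : Env []
  _∷_ : ∀ {A Γ} → ⟦ A ⟧ty → Env Γ → Env (A ∷ Γ)

⟦_⟧var : ∀ {Γ A} → Var Γ A → Env Γ → ⟦ A ⟧ty
⟦ vz ⟧var   (a ∷ ρ) = a
⟦ vs x ⟧var (a ∷ ρ) = ⟦ x ⟧var ρ

⟦_⟧ : ∀ {Γ A} → Tm Γ A → Env Γ → ⟦ A ⟧ty
⟦ var x ⟧ ρ        = ⟦ x ⟧var ρ
⟦ z ⟧ ρ            = zero
⟦ s t ⟧ ρ          = suc (⟦ t ⟧ ρ)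
⟦ unit ⟧ ρ         = tt
⟦ absurd t ⟧ ρ     = ⊥-elim (⟦ t ⟧ ρ)
⟦ pair a b ⟧ ρ     = ⟦ a ⟧ ρ , ⟦ b ⟧ ρ
⟦ fst t ⟧ ρ        = proj₁ (⟦ t ⟧ ρ)
⟦ snd t ⟧ ρ        = proj₂ (⟦ t ⟧ ρ)
⟦ lam t ⟧ ρ        = λ a → ⟦ t ⟧ (a ∷ ρ)
⟦ app f a ⟧ ρ      = ⟦ f ⟧ ρ (⟦ a ⟧ ρ)
⟦ ind _ cz cs n ⟧ ρ = iter (⟦ n ⟧ ρ)
  where
    iter : ℕ → _
    iter zero    = ⟦ cz ⟧ ρ
    iter (suc m) = ⟦ cs ⟧ (iter m ∷ (m ∷ ρ))

Nctx : ℕ → Ctx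
Nctx k = replicate k `N

envN : ∀ {k} → Vec ℕ k → Env (Nctx k)
envN []       = []
envN (x ∷ xs) = x ∷ envN xs

{-# OPTIONS --safe #-}
module Submission where

-- A code f : PR k is compiled, by structural recursion, into a term built from
-- given argument terms; composition just plugs compiled terms in as arguments.
-- Primitive recursion rec g h is ind at the tuple type N^(k+1), which lies in
-- U₀: the state carries the accumulator together with the k parameters, so the
-- step term reads the parameters off its own state variable and the argument
-- terms never have to be weakened into the step's context.

open import Defs
open import Data.Nat using (ℕ; zero; suc)
open import Data.Fin using (Fin; zero; suc)
open import Data.List using (_∷_)
open import Data.Product using (Σ; _,_; proj₁; proj₂)
open import Data.Vec using (Vec; []; _∷_; head; tail; lookup; map; tabulate)
open import Data.Vec.Properties using (lookup-map; tabulate-∘; tabulate-cong; tabulate∘lookup)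
open import Function using (_∘_)
open import Relation.Binary.PropositionalEquality
  using (_≡_; refl; cong; cong₂; sym; trans; module ≡-Reasoning)

recℕ : {A : Set} → A → (ℕ → A → A) → ℕ → A
recℕ a f zero    = a
recℕ a f (suc n) = f n (recℕ a f n)

num : ∀ {Γ} → ℕ → Tm Γ `N
num zero    = z
num (suc m) = s (num m)

⟦num⟧ : ∀ {Γ} m (ρ : Env Γ) → ⟦ num m ⟧ ρ ≡ m
⟦num⟧ zero    ρ = refl
⟦num⟧ (suc m) ρ = cong suc (⟦num⟧ m ρ)

module _ {Γ C} (p : level C ≡ 0) (cz : Tm Γ C) (cs : Tm (C ∷ `N ∷ Γ) C) (ρ : Env Γ) where

  -- The iteration in ⟦ ind … ⟧ is a where-local function of Defs and cannot be
  -- named, so induction runs over numeral indices, and a general index is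
  -- first replaced by the numeral of its value.

  ⟦ind⟧-cong : ∀ n n′ → ⟦ n ⟧ ρ ≡ ⟦ n′ ⟧ ρ → ⟦ ind p cz cs n ⟧ ρ ≡ ⟦ ind p cz cs n′ ⟧ ρ
  ⟦ind⟧-cong n n′ eq rewrite eq = refl

  ⟦ind⟧-num : ∀ m → ⟦ ind p cz cs (num m) ⟧ ρ ≡ recℕ (⟦ cz ⟧ ρ) (λ i c → ⟦ cs ⟧ (c ∷ i ∷ ρ)) m
  ⟦ind⟧-num zero    = refl
  ⟦ind⟧-num (suc m) = cong₂ (λ c n → ⟦ cs ⟧ (c ∷ n ∷ ρ)) (⟦ind⟧-num m) (⟦num⟧ m ρ)

  ⟦ind⟧ : ∀ n → ⟦ ind p cz cs n ⟧ ρ ≡ recℕ (⟦ cz ⟧ ρ) (λ i c → ⟦ cs ⟧ (c ∷ i ∷ ρ)) (⟦ n ⟧ ρ)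
  ⟦ind⟧ n = trans (⟦ind⟧-cong n (num (⟦ n ⟧ ρ)) (sym (⟦num⟧ (⟦ n ⟧ ρ) ρ))) (⟦ind⟧-num (⟦ n ⟧ ρ))

⟦_⟧* : ∀ {Γ A k} → Vec (Tm Γ A) k → Env Γ → Vec ⟦ A ⟧ty k
⟦ ts ⟧* ρ = map (λ t → ⟦ t ⟧ ρ) ts

infix 30 `N^_

`N^_ : ℕ → Ty
`N^ zero  = `⊤
`N^ suc k = `N `× `N^ k

level-`N^ : ∀ k → level (`N^ k) ≡ 0
level-`N^ zero    = refl
level-`N^ (suc k) = level-`N^ k

toVec : ∀ {k} → ⟦ `N^ k ⟧ty → Vec ℕ k
toVec {zero}  _       = []
toVec {suc k} (x , v) = x ∷ toVec v

tuple : ∀ {Γ k} → Vec (Tm Γ `N) k → Tm Γ (`N^ k)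
tuple []       = unit
tuple (t ∷ ts) = pair t (tuple ts)

untuple : ∀ {Γ k} → Tm Γ (`N^ k) → Vec (Tm Γ `N) k
untuple {k = zero}  t = []
untuple {k = suc k} t = fst t ∷ untuple (snd t)

toVec-⟦tuple⟧ : ∀ {Γ k} (ts : Vec (Tm Γ `N) k) ρ → toVec (⟦ tuple ts ⟧ ρ) ≡ ⟦ ts ⟧* ρ
toVec-⟦tuple⟧ []       ρ = refl
toVec-⟦tuple⟧ (t ∷ ts) ρ = cong (⟦ t ⟧ ρ ∷_) (toVec-⟦tuple⟧ ts ρ)

⟦untuple⟧ : ∀ {Γ k} (t : Tm Γ (`N^ k)) ρ → ⟦ untuple t ⟧* ρ ≡ toVec (⟦ t ⟧ ρ)
⟦untuple⟧ {k = zero}  t ρ = refl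
⟦untuple⟧ {k = suc k} t ρ = cong (proj₁ (⟦ t ⟧ ρ) ∷_) (⟦untuple⟧ (snd t) ρ)

mutual
  compile : ∀ {Γ k} → PR k → Vec (Tm Γ `N) k → Tm Γ `N
  compile (K c)       as       = num c
  compile S           (a ∷ []) = s a
  compile (P i)       as       = lookup as i
  compile (comp g hs) as       = compile g (compileAll hs as)
  compile (rec {k} g h) (a ∷ as) =
    fst (ind (level-`N^ (suc k)) (recInit g as) (recStep h) a)

  compileAll : ∀ {Γ k m} → Vec (PR k) m → Vec (Tm Γ `N) k → Vec (Tm Γ `N) m
  compileAll []       as = []
  compileAll (h ∷ hs) as = compile h as ∷ compileAll hs as

  recInit : ∀ {Γ k} → PR k → Vec (Tm Γ `N) k → Tm Γ (`N^ suc k)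
  recInit g as = tuple (compile g as ∷ as)

  recStep : ∀ {Γ k} → PR (suc (suc k)) → Tm (`N^ suc k ∷ `N ∷ Γ) (`N^ suc k)
  recStep h = pair (compile h (var (vs vz) ∷ untuple (var vz))) (snd (var vz))

mutual
  ⟦compile⟧ : ∀ {Γ k} (f : PR k) (as : Vec (Tm Γ `N) k) ρ →
              ⟦ compile f as ⟧ ρ ≡ evalPR f (⟦ as ⟧* ρ)
  ⟦compile⟧ (K c)       as       ρ = ⟦num⟧ c ρ
  ⟦compile⟧ S           (a ∷ []) ρ = refl
  ⟦compile⟧ (P i)       as       ρ = sym (lookup-map i _ as)
  ⟦compile⟧ (comp g hs) as       ρ =
    trans (⟦compile⟧ g (compileAll hs as) ρ) (cong (evalPR g) (⟦compileAll⟧ hs as ρ))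
  ⟦compile⟧ (rec {k} g h) (a ∷ as) ρ =
    -- head (toVec c) is proj₁ c by η for pairs
    cong head (trans (cong toVec (⟦ind⟧ (level-`N^ (suc k)) (recInit g as) (recStep h) ρ a))
                     (toVec-recℕ-recStep g h as ρ (⟦ a ⟧ ρ)))

  ⟦compileAll⟧ : ∀ {Γ k m} (hs : Vec (PR k) m) (as : Vec (Tm Γ `N) k) ρ →
                 ⟦ compileAll hs as ⟧* ρ ≡ evalAll hs (⟦ as ⟧* ρ)
  ⟦compileAll⟧ []       as ρ = refl
  ⟦compileAll⟧ (h ∷ hs) as ρ = cong₂ _∷_ (⟦compile⟧ h as ρ) (⟦compileAll⟧ hs as ρ)

  toVec-recℕ-recStep : ∀ {Γ k} (g : PR k) h (as : Vec (Tm Γ `N) k) ρ m →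
    toVec (recℕ (⟦ recInit g as ⟧ ρ) (λ i c → ⟦ recStep h ⟧ (c ∷ i ∷ ρ)) m)
      ≡ primrec g h m (⟦ as ⟧* ρ) ∷ ⟦ as ⟧* ρ
  toVec-recℕ-recStep g h as ρ zero =
    cong₂ _∷_ (⟦compile⟧ g as ρ) (toVec-⟦tuple⟧ as ρ)
  toVec-recℕ-recStep {k = k} g h as ρ (suc m) = begin
      toVec (⟦ recStep h ⟧ (c ∷ m ∷ ρ))
    ≡⟨ cong (_∷ toVec (proj₂ c)) (⟦compile⟧ h (var (vs vz) ∷ untuple (var vz)) (c ∷ m ∷ ρ)) ⟩
      evalPR h (m ∷ ⟦ untuple (var vz) ⟧* (c ∷ m ∷ ρ)) ∷ toVec (proj₂ c)
    ≡⟨ cong (λ v → evalPR h (m ∷ v) ∷ toVec (proj₂ c)) (⟦untuple⟧ (var vz) (c ∷ m ∷ ρ)) ⟩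
      evalPR h (m ∷ toVec c) ∷ tail (toVec c)
    ≡⟨ cong (λ v → evalPR h (m ∷ v) ∷ tail v) (toVec-recℕ-recStep g h as ρ m) ⟩
      primrec g h (suc m) (⟦ as ⟧* ρ) ∷ ⟦ as ⟧* ρ
    ∎
    where
      open ≡-Reasoning
      c : ⟦ `N^ suc k ⟧ty
      c = recℕ (⟦ recInit g as ⟧ ρ) (λ i c → ⟦ recStep h ⟧ (c ∷ i ∷ ρ)) m

toVar : ∀ {k} → Fin k → Var (Nctx k) `N
toVar zero    = vz
toVar (suc i) = vs (toVar i)

⟦toVar⟧ : ∀ {k} (xs : Vec ℕ k) (i : Fin k) → ⟦ toVar i ⟧var (envN xs) ≡ lookup xs i
⟦toVar⟧ (x ∷ xs) zero    = refl
⟦toVar⟧ (x ∷ xs) (suc i) = ⟦toVar⟧ xs i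

variables : ∀ k → Vec (Tm (Nctx k) `N) k
variables k = tabulate (var ∘ toVar)

⟦variables⟧ : ∀ {k} (xs : Vec ℕ k) → ⟦ variables k ⟧* (envN xs) ≡ xs
⟦variables⟧ xs = begin
    map (λ t → ⟦ t ⟧ (envN xs)) (tabulate (var ∘ toVar))
  ≡⟨ sym (tabulate-∘ _ (var ∘ toVar)) ⟩
    tabulate (λ i → ⟦ toVar i ⟧var (envN xs))
  ≡⟨ tabulate-cong (⟦toVar⟧ xs) ⟩
    tabulate (lookup xs)
  ≡⟨ tabulate∘lookup xs ⟩
    xs
  ∎
  where open ≡-Reasoning

mainTheorem2 : (k : ℕ) (f : PR k) →
    Σ (Tm (Nctx k) `N) (λ t → (xs : Vec ℕ k) → ⟦ t ⟧ (envN xs) ≡ evalPR f xs)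
mainTheorem2 k f = compile f (variables k) , λ xs →
  trans (⟦compile⟧ f (variables k) (envN xs)) (cong (evalPR f) (⟦variables⟧ xs))
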